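{- For integers $n\ge i\ge 0$, let $U_{n,i}$ be the number of G-Motzkin paths of length $n$ with exactly $i$ $\mathbf{u}$-steps. Then \[ U_{n,i}=\sum_{k=0}^{i}\binom{i}{k}\binom{n+k}{2i}C_i, \] where $C_i=\frac{1}{i+1}\binom{2i}{i}$ is the $i$-th Catalan number.
   Context: A G-Motzkin path of length $n$ is a lattice path from $(0,0)$ to $(n,0)$ that never goes below the $x$-axis and consists of up steps $\mathbf{u}=(1,1)$, down steps $\mathbf{d}=(1,-1)$, horizontal steps $\mathbf{h}=(1,0)$ and vertical steps $\mathbf{v}=(0,-1)$. -}

module Defs where

open import Data.Nat using (ℕ; zero; suc; _+_; _*_; _/_; _≤_)
open import Data.Nat.Combinatorics using (_C_)
open import Data.List using (List; []; _∷_; map; upTo)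
open import Data.Nat.ListAction using (sum)
open import Data.Maybe using (Maybe; just; nothing)
open import Relation.Binary.PropositionalEquality using (_≡_)

-- Steps of a G-Motzkin path: u = (1,1), d = (1,-1), h = (1,0), v = (0,-1).
data Step : Set where
  u d h v : Step

run : ℕ → List Step → Maybe ℕ
run k [] = just k
run k (u ∷ p) = run (suc k) p
run zero (d ∷ p) = nothing
run (suc k) (d ∷ p) = run k p
run k (h ∷ p) = run k p
run zero (v ∷ p) = nothing
run (suc k) (v ∷ p) = run k p

hlen : List Step → ℕ
hlen [] = 0
hlen (v ∷ p) = hlen p
hlen (_ ∷ p) = suc (hlen p)

ucount : List Step → ℕ
ucount [] = 0
ucount (u ∷ p) = suc (ucount p)
ucount (_ ∷ p) = ucount p

record IsGMotzkin (n : ℕ) (p : List Step) : Set where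
  field
    nonneg-ends-at-0 : run 0 p ≡ just 0
    length-n : hlen p ≡ n

-- Catalan number C_i = binom(2i,i)/(i+1)  (exact division).
catalan : ℕ → ℕ
catalan i = ((2 * i) C i) / suc i

formula : ℕ → ℕ → ℕ
formula n i = sum (map (λ k → (i C k) * ((n + k) C (2 * i)) * catalan i) (upTo (suc i)))

-- Forget the h-steps of a path from height k with i up-steps and read its d- and v-steps
-- alike as down-steps: what remains is a ballot word with i up- and i + k down-steps, and
-- ballot 0 i is the Catalan number. The path is recovered from the word by choosing which
-- down-steps are vertical and where the h-steps go, in a number of ways that depends only
-- on the numbers of steps in the word. Instead of building this bijection, the proof
-- enumerates the paths by their first step and checks that the resulting product obeys
-- the same first-step recurrence.
module Submission where

open import Defs
open import Data.Nat using (ℕ; zero; suc; _+_; _*_; _/_; _<_; _≤_; s≤s; z≤n)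
open import Data.Nat.Properties
open import Algebra.Properties.CommutativeSemigroup +-commutativeSemigroup
  using (x∙yz≈y∙xz) renaming (interchange to +-interchange)
open import Data.Nat.Combinatorics
  using (_C_; nCk+nC[k+1]≡[n+1]C[k+1]; nCk≡nC[n∸k]; nCn≡1; nC1≡n; k>n⇒nCk≡0)
open import Data.Nat.DivMod using (m*n/n≡m)
open import Data.Nat.ListAction using (sum)
open import Data.Nat.ListAction.Properties using (sum-++)
open import Data.Nat.Tactic.RingSolver using (solve-∀)
open import Data.List using (List; []; _∷_; [_]; _++_; map; concat; length; applyUpTo)
open import Data.List.Properties
  using (length-++; length-map; map-∘; map-cong; applyUpTo-∷ʳ; map-upTo; ∷-injectiveˡ; ∷-injectiveʳ)
open import Data.List.Membership.Propositional using (_∈_)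
open import Data.List.Membership.Propositional.Properties
  using (∈-map⁺; ∈-map⁻; ∈-++⁺ʳ; ∈-++⁻; ∈-concat⁺′; ∈-concat⁻′)
open import Data.List.Relation.Unary.Any using (here; there)
open import Data.List.Relation.Unary.All using ([]; _∷_)
import Data.List.Relation.Unary.All as All
import Data.List.Relation.Unary.All.Properties as All
open import Data.List.Relation.Unary.AllPairs using ([]; _∷_)
import Data.List.Relation.Unary.AllPairs as AllPairs
import Data.List.Relation.Unary.AllPairs.Properties as AllPairs
open import Data.List.Relation.Unary.Unique.Propositional using (Unique)
import Data.List.Relation.Unary.Unique.Propositional.Properties as Unique
open import Data.List.Relation.Binary.Disjoint.Propositional using (Disjoint)
import Data.List.Relation.Binary.Disjoint.Propositional.Properties as Disjoint
open import Data.Maybe using (just)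
open import Data.Product using (Σ; _×_; _,_)
open import Data.Sum using (inj₁; inj₂)
open import Function.Bundles using (_⇔_; mk⇔)
open import Function.Properties.Equivalence using () renaming (trans to ⇔-trans)
open import Relation.Binary.PropositionalEquality
  using (_≡_; _≢_; refl; sym; trans; cong; cong₂; module ≡-Reasoning)

C-sym : ∀ a b {n} → a + b ≡ n → n C a ≡ n C b
C-sym a b refl = trans (nCk≡nC[n∸k] (m≤m+n a b)) (cong ((a + b) C_) (m+n∸m≡n a b))

C-absorption : ∀ n k → suc k * (suc n C suc k) ≡ suc n * (n C k)
C-absorption zero    zero    = refl
C-absorption zero    (suc k) = *-zeroʳ (suc (suc k))
C-absorption (suc n) zero    =
  trans (+-identityʳ (suc (suc n) C 1)) (trans (nC1≡n (suc (suc n))) (sym (*-identityʳ _)))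
C-absorption (suc n) (suc k) = begin
  suc (suc k) * (suc (suc n) C suc (suc k))
    ≡⟨ cong (suc (suc k) *_) (nCk+nC[k+1]≡[n+1]C[k+1] (suc n) (suc k)) ⟨
  suc (suc k) * (X + Y)
    ≡⟨ split k X Y ⟩
  suc k * X + X + suc (suc k) * Y
    ≡⟨ cong₂ (λ a b → a + X + b) (C-absorption n k) (C-absorption n (suc k)) ⟩
  suc n * (n C k) + X + suc n * (n C suc k)
    ≡⟨ merge n (n C k) X (n C suc k) ⟩
  suc n * (n C k + n C suc k) + X
    ≡⟨ cong (λ a → suc n * a + X) (nCk+nC[k+1]≡[n+1]C[k+1] n k) ⟩
  suc n * X + X
    ≡⟨ +-comm (suc n * X) X ⟩
  suc (suc n) * X ∎
  where
  open ≡-Reasoning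
  X = suc n C suc k
  Y = suc n C suc (suc k)
  split : ∀ k x y → suc (suc k) * (x + y) ≡ suc k * x + x + suc (suc k) * y
  split = solve-∀
  merge : ∀ n a x b → suc n * a + x + suc n * b ≡ suc n * (a + b) + x
  merge = solve-∀

C-ratio : ∀ a b → (suc (a + b) C a) * suc b ≡ (suc (a + b) C suc a) * suc a
C-ratio a b = begin
  (suc (a + b) C a) * suc b         ≡⟨ cong (_* suc b) (C-sym a (suc b) (+-suc a b)) ⟩
  (suc (a + b) C suc b) * suc b     ≡⟨ *-comm _ (suc b) ⟩
  suc b * (suc (a + b) C suc b)     ≡⟨ cong (λ m → suc b * (suc m C suc b)) (+-comm a b) ⟩
  suc b * (suc (b + a) C suc b)     ≡⟨ C-absorption (b + a) b ⟩
  suc (b + a) * ((b + a) C b)       ≡⟨ cong (λ m → suc m * (m C b)) (+-comm b a) ⟩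
  suc (a + b) * ((a + b) C b)       ≡⟨ cong (suc (a + b) *_) (C-sym b a (+-comm b a)) ⟩
  suc (a + b) * ((a + b) C a)       ≡⟨ C-absorption (a + b) a ⟨
  suc a * (suc (a + b) C suc a)     ≡⟨ *-comm (suc a) _ ⟩
  (suc (a + b) C suc a) * suc a     ∎
  where open ≡-Reasoning

-- ballot k i counts the words in i up-steps and i + k down-steps that, started at
-- height k, never go below the axis.
ballot : ℕ → ℕ → ℕ
ballot k       zero    = 1
ballot zero    (suc i) = ballot 1 i
ballot (suc k) (suc i) = ballot (suc (suc k)) i + ballot k (suc i)

ballot-one : ∀ k → ballot k 1 ≡ suc k
ballot-one zero    = refl
ballot-one (suc k) = cong suc (ballot-one k)

-- The ballot formula ballot k i = C(2i+k, i) − C(2i+k, i−1), stated without subtraction.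
ballot-hook : ∀ k j {n} → k + suc j + suc j ≡ n → ballot k (suc j) + n C j ≡ n C suc j
ballot-hook k zero refl = begin
  ballot k 1 + 1     ≡⟨ cong (_+ 1) (ballot-one k) ⟩
  1 + (k + 1)        ≡⟨ +-comm 1 (k + 1) ⟩
  k + 1 + 1          ≡⟨ nC1≡n (k + 1 + 1) ⟨
  (k + 1 + 1) C 1    ∎
  where open ≡-Reasoning
ballot-hook zero (suc j) {suc m} refl = begin
  a + suc m C suc j
    ≡⟨ cong (a +_) (nCk+nC[k+1]≡[n+1]C[k+1] m j) ⟨
  a + (m C j + m C suc j)
    ≡⟨ +-assoc a (m C j) (m C suc j) ⟨
  a + m C j + m C suc j
    ≡⟨ cong (_+ m C suc j) (ballot-hook 1 j (sym (+-suc (suc j) (suc j)))) ⟩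
  m C suc j + m C suc j
    ≡⟨ cong (m C suc j +_) (C-sym (suc j) (suc (suc j)) refl) ⟩
  m C suc j + m C suc (suc j)
    ≡⟨ nCk+nC[k+1]≡[n+1]C[k+1] m (suc j) ⟩
  suc m C suc (suc j) ∎
  where
  open ≡-Reasoning
  a = ballot 1 (suc j)
ballot-hook (suc k) (suc j) {suc m} refl = begin
  (a + b) + suc m C suc j
    ≡⟨ cong (a + b +_) (nCk+nC[k+1]≡[n+1]C[k+1] m j) ⟨
  (a + b) + (m C j + m C suc j)
    ≡⟨ +-interchange a b (m C j) (m C suc j) ⟩
  (a + m C j) + (b + m C suc j)
    ≡⟨ cong₂ _+_ (ballot-hook (suc (suc k)) j (index k j)) (ballot-hook k (suc j) refl) ⟩
  m C suc j + m C suc (suc j)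
    ≡⟨ nCk+nC[k+1]≡[n+1]C[k+1] m (suc j) ⟩
  suc m C suc (suc j) ∎
  where
  open ≡-Reasoning
  a = ballot (suc (suc k)) (suc j)
  b = ballot k (suc (suc j))
  index : ∀ k j → suc (suc k) + suc j + suc j ≡ k + suc (suc j) + suc (suc j)
  index = solve-∀

central-binomial : ∀ i → (i + i) C i ≡ suc i * ballot 0 i
central-binomial zero    = refl
central-binomial (suc j) = sym (+-cancelʳ-≡ (X * suc j) (suc (suc j) * b) X (begin
  suc (suc j) * b + X * suc j              ≡⟨ cong (suc (suc j) * b +_) (C-ratio j (suc j)) ⟨
  suc (suc j) * b + Y * suc (suc j)        ≡⟨ cong (suc (suc j) * b +_) (*-comm Y _) ⟩
  suc (suc j) * b + suc (suc j) * Y        ≡⟨ *-distribˡ-+ (suc (suc j)) b Y ⟨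
  suc (suc j) * (b + Y)                    ≡⟨ cong (suc (suc j) *_) (ballot-hook 0 j refl) ⟩
  suc (suc j) * X                          ≡⟨ cong (X +_) (*-comm (suc j) X) ⟩
  X + X * suc j                            ∎))
  where
  open ≡-Reasoning
  X = (suc j + suc j) C suc j
  Y = (suc j + suc j) C j
  b = ballot 0 (suc j)

catalan≡ballot : ∀ i → catalan i ≡ ballot 0 i
catalan≡ballot i = begin
  ((i + (i + 0)) C i) / suc i    ≡⟨ cong (λ m → ((i + m) C i) / suc i) (+-identityʳ i) ⟩
  ((i + i) C i) / suc i          ≡⟨ cong (_/ suc i) (central-binomial i) ⟩
  (suc i * ballot 0 i) / suc i   ≡⟨ cong (_/ suc i) (*-comm (suc i) (ballot 0 i)) ⟩
  (ballot 0 i * suc i) / suc i   ≡⟨ m*n/n≡m (ballot 0 i) (suc i) ⟩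
  ballot 0 i                     ∎
  where open ≡-Reasoning

∑< : ℕ → (ℕ → ℕ) → ℕ
∑< m f = sum (applyUpTo f m)

syntax ∑< m (λ k → e) = ∑[ k < m ] e

∑-cong : ∀ m {f g : ℕ → ℕ} → (∀ k → k < m → f k ≡ g k) → ∑< m f ≡ ∑< m g
∑-cong zero    f≡g = refl
∑-cong (suc m) f≡g = cong₂ _+_ (f≡g 0 (s≤s z≤n)) (∑-cong m (λ k k<m → f≡g (suc k) (s≤s k<m)))

∑-zero : ∀ m {f : ℕ → ℕ} → (∀ k → k < m → f k ≡ 0) → ∑< m f ≡ 0
∑-zero zero    f≡0 = refl
∑-zero (suc m) f≡0 = cong₂ _+_ (f≡0 0 (s≤s z≤n)) (∑-zero m (λ k k<m → f≡0 (suc k) (s≤s k<m)))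

∑-last : ∀ m (f : ℕ → ℕ) → ∑< (suc m) f ≡ ∑< m f + f m
∑-last m f = begin
  sum (applyUpTo f (suc m))          ≡⟨ cong sum (applyUpTo-∷ʳ f m) ⟨
  sum (applyUpTo f m ++ [ f m ])     ≡⟨ sum-++ (applyUpTo f m) [ f m ] ⟩
  ∑< m f + (f m + 0)                 ≡⟨ cong (∑< m f +_) (+-identityʳ (f m)) ⟩
  ∑< m f + f m                       ∎
  where open ≡-Reasoning

∑-+ : ∀ m (f g : ℕ → ℕ) → ∑[ k < m ] (f k + g k) ≡ ∑< m f + ∑< m g
∑-+ zero    f g = refl
∑-+ (suc m) f g = trans (cong (f 0 + g 0 +_) (∑-+ m (λ k → f (suc k)) (λ k → g (suc k))))
                        (+-interchange (f 0) (g 0) _ _)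

∑-*ʳ : ∀ m (f : ℕ → ℕ) c → ∑[ k < m ] (f k * c) ≡ ∑< m f * c
∑-*ʳ zero    f c = refl
∑-*ʳ (suc m) f c = trans (cong (f 0 * c +_) (∑-*ʳ m (λ k → f (suc k)) c))
                         (sym (*-distribʳ-+ c (f 0) _))

-- decorations L s n counts the ways to turn a fixed word of L up/down-steps, s of them
-- down, into a path of length n: choose the k down-steps that become v-steps, then
-- distribute the n + k − L h-steps among the L + 1 gaps of the word.
decorations : ℕ → ℕ → ℕ → ℕ
decorations L s n = ∑[ k < suc s ] ((s C k) * ((n + k) C L))

decorations-suc-length : ∀ L s n →
  decorations (suc L) s (suc n) ≡ decorations L s n + decorations (suc L) s n
decorations-suc-length L s n = trans
  (∑-cong (suc s) λ k _ → trans (cong ((s C k) *_) (sym (nCk+nC[k+1]≡[n+1]C[k+1] (n + k) L)))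
                                 (*-distribˡ-+ (s C k) ((n + k) C L) ((n + k) C suc L)))
  (∑-+ (suc s) (λ k → (s C k) * ((n + k) C L)) (λ k → (s C k) * ((n + k) C suc L)))

decorations-suc-downs : ∀ L s n →
  decorations L (suc s) n ≡ decorations L s (suc n) + decorations L s n
decorations-suc-downs L s n = begin
  decorations L (suc s) n
    ≡⟨⟩
  1 * f 0 + ∑[ k < suc s ] ((suc s C suc k) * f (suc k))
    ≡⟨ cong (1 * f 0 +_) (∑-cong (suc s) λ k _ → trans
         (cong (_* f (suc k)) (sym (nCk+nC[k+1]≡[n+1]C[k+1] s k)))
         (*-distribʳ-+ (f (suc k)) (s C k) (s C suc k))) ⟩
  1 * f 0 + ∑[ k < suc s ] (g′ k + g (suc k))
    ≡⟨ cong (1 * f 0 +_) (∑-+ (suc s) g′ (λ k → g (suc k))) ⟩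
  1 * f 0 + (∑< (suc s) g′ + ∑[ k < suc s ] g (suc k))
    ≡⟨ x∙yz≈y∙xz (1 * f 0) (∑< (suc s) g′) (∑[ k < suc s ] g (suc k)) ⟩
  -- s C 0 computes to 1, so 1 * f 0 and the last sum fold to ∑< (suc (suc s)) g.
  ∑< (suc s) g′ + ∑< (suc (suc s)) g
    ≡⟨ cong₂ _+_ (∑-cong (suc s) λ k _ → cong (λ m → (s C k) * (m C L)) (+-suc n k))
                 (∑-last (suc s) g) ⟩
  decorations L s (suc n) + (decorations L s n + (s C suc s) * f (suc s))
    ≡⟨ cong (λ c → decorations L s (suc n) + (decorations L s n + c * f (suc s)))
            (k>n⇒nCk≡0 (n<1+n s)) ⟩
  decorations L s (suc n) + (decorations L s n + 0)
    ≡⟨ cong (decorations L s (suc n) +_) (+-identityʳ _) ⟩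
  decorations L s (suc n) + decorations L s n ∎
  where
  open ≡-Reasoning
  f g g′ : ℕ → ℕ
  f k = (n + k) C L
  g k = (s C k) * f k
  g′ k = (s C k) * f (suc k)

decorations-diagonal : ∀ L → decorations L L 0 ≡ 1
decorations-diagonal L = begin
  decorations L L 0
    ≡⟨ ∑-last L (λ k → (L C k) * (k C L)) ⟩
  ∑[ k < L ] ((L C k) * (k C L)) + (L C L) * (L C L)
    ≡⟨ cong₂ _+_ (∑-zero L λ k k<L → trans (cong ((L C k) *_) (k>n⇒nCk≡0 k<L)) (*-zeroʳ (L C k)))
                 (cong₂ _*_ (nCn≡1 L) (nCn≡1 L)) ⟩
  1 ∎
  where open ≡-Reasoning

decorations-vanish : ∀ {L s} → s < L → decorations L s 0 ≡ 0
decorations-vanish {L} {s} s<L = ∑-zero (suc s) λ k k≤s →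
  trans (cong ((s C k) *_) (k>n⇒nCk≡0 (≤-<-trans (<⇒≤pred k≤s) s<L))) (*-zeroʳ (s C k))

fillings : ℕ → ℕ → ℕ → ℕ
fillings k i = decorations (i + (i + k)) (i + k)

fillings-suc-ups : ∀ k i n →
  fillings k (suc i) (suc n) ≡ fillings (suc k) i n + fillings k (suc i) n
fillings-suc-ups k i n = trans
  (decorations-suc-length (i + suc (i + k)) (suc (i + k)) n)
  (cong (_+ fillings k (suc i) n) (sym (cong (λ s → decorations (i + s) s n) (+-suc i k))))

fillings-suc-height : ∀ k i n →
  fillings (suc k) i (suc n) ≡ fillings k i (suc n) + fillings k i n + fillings (suc k) i n
fillings-suc-height k i n = begin
  fillings (suc k) i (suc n)
    ≡⟨ shift (suc n) ⟩
  decorations (suc L) (suc s) (suc n)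
    ≡⟨ decorations-suc-length L (suc s) n ⟩
  decorations L (suc s) n + decorations (suc L) (suc s) n
    ≡⟨ cong₂ _+_ (decorations-suc-downs L s n) (sym (shift n)) ⟩
  fillings k i (suc n) + fillings k i n + fillings (suc k) i n ∎
  where
  open ≡-Reasoning
  L = i + (i + k)
  s = i + k
  shift : ∀ m → fillings (suc k) i m ≡ decorations (suc L) (suc s) m
  shift m = cong₂ (λ L′ s′ → decorations L′ s′ m) (trans (cong (i +_) (+-suc i k)) (+-suc i s)) (+-suc i k)

pathCount : ℕ → ℕ → ℕ → ℕ
pathCount k n i = ballot k i * fillings k i n

pathCount-empty : ∀ k → pathCount k 0 0 ≡ 1
pathCount-empty k = trans (+-identityʳ (fillings k 0 0)) (decorations-diagonal k)

pathCount-no-length : ∀ k i → pathCount k 0 (suc i) ≡ 0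
pathCount-no-length k i = trans
  (cong (ballot k (suc i) *_) (decorations-vanish (m<n+m (suc i + k) {suc i} (s≤s z≤n))))
  (*-zeroʳ (ballot k (suc i)))

length-concat : ∀ {A : Set} (xss : List (List A)) → length (concat xss) ≡ sum (map length xss)
length-concat []         = refl
length-concat (xs ∷ xss) = trans (length-++ xs) (cong (length xs +_) (length-concat xss))

∷-disjoint : ∀ {A : Set} {x y : A} {xss yss : List (List A)} → x ≢ y →
  Disjoint (map (x ∷_) xss) (map (y ∷_) yss)
∷-disjoint {x = x} {y} x≢y (p∈xss , p∈yss) with ∈-map⁻ (x ∷_) p∈xss | ∈-map⁻ (y ∷_) p∈yss
... | _ , _ , refl | _ , _ , x∷q≡y∷q′ = x≢y (∷-injectiveˡ x∷q≡y∷q′)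

IsPathFrom : ℕ → ℕ → ℕ → List Step → Set
IsPathFrom k n i p = run k p ≡ just 0 × hlen p ≡ n × ucount p ≡ i

steps : List Step
steps = u ∷ d ∷ h ∷ v ∷ []

∈-steps : ∀ s → s ∈ steps
∈-steps u = here refl
∈-steps d = there (here refl)
∈-steps h = there (there (here refl))
∈-steps v = there (there (there (here refl)))

steps-unique : Unique steps
steps-unique =
  ((λ ()) ∷ (λ ()) ∷ (λ ()) ∷ []) ∷ ((λ ()) ∷ (λ ()) ∷ []) ∷ ((λ ()) ∷ []) ∷ [] ∷ []

emptyPaths : ℕ → ℕ → ℕ → List (List Step)
emptyPaths zero zero zero = [ [] ]
emptyPaths _    _    _    = []

mutual
  after : Step → ℕ → ℕ → ℕ → List (List Step)
  after u k       (suc n) (suc i) = paths (suc k) n i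
  after d (suc k) (suc n) i       = paths k n i
  after h k       (suc n) i       = paths k n i
  after v (suc k) n       i       = paths k n i
  after _ _       _       _       = []

  branch : ℕ → ℕ → ℕ → Step → List (List Step)
  branch k n i s = map (s ∷_) (after s k n i)

  paths : ℕ → ℕ → ℕ → List (List Step)
  paths k n i = emptyPaths k n i ++ concat (map (branch k n i) steps)

emptyPaths-sound : ∀ k n i {p} → p ∈ emptyPaths k n i → IsPathFrom k n i p
emptyPaths-sound zero    zero    zero    (here refl) = refl , refl , refl
emptyPaths-sound zero    zero    (suc i) ()
emptyPaths-sound zero    (suc n) i       ()
emptyPaths-sound (suc k) n       i       ()

mutual
  ∈-paths⁻ : ∀ k n i {p} → p ∈ paths k n i → IsPathFrom k n i p
  ∈-paths⁻ k n i p∈ with ∈-++⁻ (emptyPaths k n i) p∈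
  ... | inj₁ p∈empty = emptyPaths-sound k n i p∈empty
  ... | inj₂ p∈branches with ∈-concat⁻′ (map (branch k n i) steps) p∈branches
  ... | _ , p∈b , b∈ with ∈-map⁻ (branch k n i) b∈
  ... | s , _ , refl with ∈-map⁻ (s ∷_) p∈b
  ... | _ , q∈ , refl = ∈-after⁻ s k n i q∈

  ∈-after⁻ : ∀ s k n i {q} → q ∈ after s k n i → IsPathFrom k n i (s ∷ q)
  ∈-after⁻ u k       (suc n) (suc i) q∈ = let r , l , c = ∈-paths⁻ (suc k) n i q∈ in r , cong suc l , cong suc c
  ∈-after⁻ d (suc k) (suc n) i       q∈ = let r , l , c = ∈-paths⁻ k n i q∈ in r , cong suc l , c
  ∈-after⁻ h k       (suc n) i       q∈ = let r , l , c = ∈-paths⁻ k n i q∈ in r , cong suc l , c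
  ∈-after⁻ v (suc k) n       i       q∈ = ∈-paths⁻ k n i q∈
  ∈-after⁻ u k       zero    i       ()
  ∈-after⁻ u k       (suc n) zero    ()
  ∈-after⁻ d zero    n       i       ()
  ∈-after⁻ d (suc k) zero    i       ()
  ∈-after⁻ h k       zero    i       ()
  ∈-after⁻ v zero    n       i       ()

∷-∈-paths : ∀ s k n i {q} → q ∈ after s k n i → s ∷ q ∈ paths k n i
∷-∈-paths s k n i q∈ =
  ∈-++⁺ʳ (emptyPaths k n i) (∈-concat⁺′ (∈-map⁺ (s ∷_) q∈) (∈-map⁺ (branch k n i) (∈-steps s)))

mutual
  ∈-paths⁺ : ∀ k n i {p} → IsPathFrom k n i p → p ∈ paths k n i
  ∈-paths⁺ k n i {[]}    (refl , refl , refl) = here refl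
  ∈-paths⁺ k n i {s ∷ q} isPath               = ∷-∈-paths s k n i (∈-after⁺ s k n i isPath)

  ∈-after⁺ : ∀ s k n i {q} → IsPathFrom k n i (s ∷ q) → q ∈ after s k n i
  ∈-after⁺ u k       _ _ (r , refl , refl) = ∈-paths⁺ (suc k) _ _ (r , refl , refl)
  ∈-after⁺ d zero    _ _ (() , _)
  ∈-after⁺ d (suc k) _ i (r , refl , c)    = ∈-paths⁺ k _ i (r , refl , c)
  ∈-after⁺ h k       _ i (r , refl , c)    = ∈-paths⁺ k _ i (r , refl , c)
  ∈-after⁺ v zero    _ _ (() , _)
  ∈-after⁺ v (suc k) n i isPath            = ∈-paths⁺ k n i isPath

∈-paths⇔ : ∀ k n i p → p ∈ paths k n i ⇔ IsPathFrom k n i p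
∈-paths⇔ k n i p = mk⇔ (∈-paths⁻ k n i) (∈-paths⁺ k n i)

emptyPaths-disjoint : ∀ k n i {s} {xss : List (List Step)} → Disjoint (emptyPaths k n i) (map (s ∷_) xss)
emptyPaths-disjoint zero zero zero {s} (here refl , []∈xss) with ∈-map⁻ (s ∷_) []∈xss
... | _ , _ , ()
emptyPaths-disjoint zero    zero    (suc i) (() , _)
emptyPaths-disjoint zero    (suc n) i       (() , _)
emptyPaths-disjoint (suc k) n       i       (() , _)

emptyPaths-unique : ∀ k n i → Unique (emptyPaths k n i)
emptyPaths-unique zero    zero    zero    = [] ∷ []
emptyPaths-unique zero    zero    (suc i) = []
emptyPaths-unique zero    (suc n) i       = []
emptyPaths-unique (suc k) n       i       = []

mutual
  paths-unique : ∀ k n i → Unique (paths k n i)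
  paths-unique k n i = Unique.++⁺ (emptyPaths-unique k n i)
    (Unique.concat⁺
      (All.map⁺ {f = branch k n i} (All.universal (λ s → Unique.map⁺ ∷-injectiveʳ (after-unique s k n i)) steps))
      (AllPairs.map⁺ {f = branch k n i} (AllPairs.map ∷-disjoint steps-unique)))
    (Disjoint.concat⁺ʳ
      (All.map⁺ {f = branch k n i} (All.universal (λ _ {p} → emptyPaths-disjoint k n i {v = p}) steps)))

  after-unique : ∀ s k n i → Unique (after s k n i)
  after-unique u k       (suc n) (suc i) = paths-unique (suc k) n i
  after-unique d (suc k) (suc n) i       = paths-unique k n i
  after-unique h k       (suc n) i       = paths-unique k n i
  after-unique v (suc k) n       i       = paths-unique k n i
  after-unique u k       zero    i       = []
  after-unique u k       (suc n) zero    = []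
  after-unique d zero    n       i       = []
  after-unique d (suc k) zero    i       = []
  after-unique h k       zero    i       = []
  after-unique v zero    n       i       = []

afterCount : Step → ℕ → ℕ → ℕ → ℕ
afterCount u k       (suc n) (suc i) = pathCount (suc k) n i
afterCount d (suc k) (suc n) i       = pathCount k n i
afterCount h k       (suc n) i       = pathCount k n i
afterCount v (suc k) n       i       = pathCount k n i
afterCount _ _       _       _       = 0

pathCount-recurrence : ∀ k n i →
  pathCount k n i ≡ length (emptyPaths k n i) + sum (map (λ s → afterCount s k n i) steps)
pathCount-recurrence zero    zero    zero    = refl
pathCount-recurrence zero    zero    (suc i) = pathCount-no-length 0 i
pathCount-recurrence (suc k) zero    zero    =
  trans (pathCount-empty (suc k)) (cong (_+ 0) (sym (pathCount-empty k)))
pathCount-recurrence (suc k) zero    (suc i) =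
  trans (pathCount-no-length (suc k) i) (cong (_+ 0) (sym (pathCount-no-length k i)))
pathCount-recurrence zero    (suc n) zero    = refl
pathCount-recurrence zero    (suc n) (suc i) = begin
  b * fillings 0 (suc i) (suc n)  ≡⟨ cong (b *_) (fillings-suc-ups 0 i n) ⟩
  b * (x + y)                     ≡⟨ *-distribˡ-+ b x y ⟩
  b * x + b * y                   ≡⟨ cong (b * x +_) (+-identityʳ (b * y)) ⟨
  b * x + (b * y + 0)             ∎
  where
  open ≡-Reasoning
  b = ballot 1 i
  x = fillings 1 i n
  y = fillings 0 (suc i) n
pathCount-recurrence (suc k) (suc n) zero = begin
  1 * fillings (suc k) 0 (suc n)        ≡⟨ cong (1 *_) (fillings-suc-height k 0 n) ⟩
  1 * (z + w + y)                       ≡⟨ reorder z w y ⟩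
  1 * w + (1 * y + (1 * z + 0))         ∎
  where
  open ≡-Reasoning
  y = fillings (suc k) 0 n
  z = fillings k 0 (suc n)
  w = fillings k 0 n
  reorder : ∀ z w y → 1 * (z + w + y) ≡ 1 * w + (1 * y + (1 * z + 0))
  reorder = solve-∀
pathCount-recurrence (suc k) (suc n) (suc i) = begin
  (b₁ + b₂) * F
    ≡⟨ *-distribʳ-+ F b₁ b₂ ⟩
  b₁ * F + b₂ * F
    ≡⟨ cong₂ _+_ (cong (b₁ *_) (fillings-suc-ups (suc k) i n)) (cong (b₂ *_) (fillings-suc-height k (suc i) n)) ⟩
  b₁ * (x + y) + b₂ * (z + w + y)
    ≡⟨ reorder b₁ b₂ x y z w ⟩
  b₁ * x + (b₂ * w + ((b₁ + b₂) * y + (b₂ * z + 0))) ∎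
  where
  open ≡-Reasoning
  b₁ = ballot (suc (suc k)) i
  b₂ = ballot k (suc i)
  F = fillings (suc k) (suc i) (suc n)
  x = fillings (suc (suc k)) i n
  y = fillings (suc k) (suc i) n
  z = fillings k (suc i) (suc n)
  w = fillings k (suc i) n
  reorder : ∀ b₁ b₂ x y z w →
    b₁ * (x + y) + b₂ * (z + w + y) ≡ b₁ * x + (b₂ * w + ((b₁ + b₂) * y + (b₂ * z + 0)))
  reorder = solve-∀

mutual
  length-paths : ∀ k n i → length (paths k n i) ≡ pathCount k n i
  length-paths k n i = begin
    length (emptyPaths k n i ++ concat (map (branch k n i) steps))
      ≡⟨ length-++ (emptyPaths k n i) ⟩
    length (emptyPaths k n i) + length (concat (map (branch k n i) steps))
      ≡⟨ cong (length (emptyPaths k n i) +_) (length-concat (map (branch k n i) steps)) ⟩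
    length (emptyPaths k n i) + sum (map length (map (branch k n i) steps))
      ≡⟨ cong (λ ls → length (emptyPaths k n i) + sum ls) branch-lengths ⟩
    length (emptyPaths k n i) + sum (map (λ s → afterCount s k n i) steps)
      ≡⟨ pathCount-recurrence k n i ⟨
    pathCount k n i ∎
    where
    open ≡-Reasoning
    branch-lengths : map length (map (branch k n i) steps) ≡ map (λ s → afterCount s k n i) steps
    branch-lengths = trans (sym (map-∘ {g = length} {f = branch k n i} steps))
      (map-cong (λ s → trans (length-map (s ∷_) (after s k n i)) (length-after s k n i)) steps)

  length-after : ∀ s k n i → length (after s k n i) ≡ afterCount s k n i
  length-after u k       (suc n) (suc i) = length-paths (suc k) n i
  length-after d (suc k) (suc n) i       = length-paths k n i
  length-after h k       (suc n) i       = length-paths k n i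
  length-after v (suc k) n       i       = length-paths k n i
  length-after u k       zero    i       = refl
  length-after u k       (suc n) zero    = refl
  length-after d zero    n       i       = refl
  length-after d (suc k) zero    i       = refl
  length-after h k       zero    i       = refl
  length-after v zero    n       i       = refl

pathCount≡formula : ∀ n i → pathCount 0 n i ≡ formula n i
pathCount≡formula n i = begin
  ballot 0 i * decorations (2 * i) (i + 0) n
    ≡⟨ cong₂ _*_ (sym (catalan≡ballot i)) (cong (λ s → decorations (2 * i) s n) (+-identityʳ i)) ⟩
  catalan i * decorations (2 * i) i n
    ≡⟨ *-comm (catalan i) _ ⟩
  decorations (2 * i) i n * catalan i
    ≡⟨ ∑-*ʳ (suc i) (λ k → (i C k) * ((n + k) C (2 * i))) (catalan i) ⟨
  ∑[ k < suc i ] ((i C k) * ((n + k) C (2 * i)) * catalan i)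
    ≡⟨ cong sum (map-upTo (λ k → (i C k) * ((n + k) C (2 * i)) * catalan i) (suc i)) ⟨
  formula n i ∎
  where open ≡-Reasoning

isPathFrom-origin⇔ : ∀ n i p → IsPathFrom 0 n i p ⇔ (IsGMotzkin n p × ucount p ≡ i)
isPathFrom-origin⇔ n i p = mk⇔
  (λ (r , l , c) → record { nonneg-ends-at-0 = r ; length-n = l } , c)
  (λ (g , c) → IsGMotzkin.nonneg-ends-at-0 g , IsGMotzkin.length-n g , c)

-- The identity holds for every i; when i > n both sides vanish.
theorem2p12 : (n i : ℕ) → i ≤ n →
    Σ (List (List Step)) (λ L →
      Unique L ×
      ((p : List Step) → (p ∈ L) ⇔ (IsGMotzkin n p × ucount p ≡ i)) ×
      length L ≡ formula n i)
theorem2p12 n i _ =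
  paths 0 n i ,
  paths-unique 0 n i ,
  (λ p → ⇔-trans (∈-paths⇔ 0 n i p) (isPathFrom-origin⇔ n i p)) ,
  trans (length-paths 0 n i) (pathCount≡formula n i)
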